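{- For all positive integers $n$ and $k$ with $k \geq 3$, there exists an induced subgraph of the Hamming graph $H(n,k)$ with $\alpha(H(n,k))+1$ vertices and maximum degree $1$.
   Context: For a graph $G$, $\alpha(G)$ denotes its independence number. The Hamming graph $H(n,k)$ has vertex set $\{0,1,\dots,k-1\}^n$, two vertices being adjacent if and only if the corresponding vectors differ in exactly one coordinate. -}

module Defs where

open import Data.Nat using (ℕ; zero; suc; _+_; _≤_)
open import Data.Fin using (Fin)
open import Data.Fin.Properties using () renaming (_≟_ to _≟ᶠ_)
open import Data.Vec using (Vec; []; _∷_)
open import Data.List using (List; length; filter)
open import Data.List.Relation.Unary.All using (All)
open import Data.List.Relation.Unary.Any using (Any)
open import Data.List.Relation.Unary.Unique.Propositional using (Unique)
open import Data.Product using (Σ; _×_)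
open import Relation.Nullary using (¬_; does)
open import Relation.Binary.PropositionalEquality using (_≡_)
open import Data.Nat.Properties using () renaming (_≟_ to _≟ℕ_)
open import Data.Bool using (if_then_else_)

Word : ℕ → ℕ → Set
Word n k = Vec (Fin k) n

dist : ∀ {n k} → Word n k → Word n k → ℕ
dist []       []       = 0
dist (x ∷ xs) (y ∷ ys) = (if does (x ≟ᶠ y) then 0 else 1) + dist xs ys

Adj : ∀ {n k} → Word n k → Word n k → Set
Adj v w = dist v w ≡ 1

-- A finite vertex set, given as a duplicate-free list.
-- Independent: no two vertices of the set are adjacent.
Independent : ∀ {n k} → List (Word n k) → Set
Independent S = All (λ v → All (λ w → ¬ Adj v w) S) S

IsIndependenceNumber : ℕ → ℕ → ℕ → Set
IsIndependenceNumber n k m =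
  Σ (List (Word n k)) (λ S → Unique S × Independent S × length S ≡ m)
  × (∀ (S : List (Word n k)) → Unique S → Independent S → length S ≤ m)

degIn : ∀ {n k} → List (Word n k) → Word n k → ℕ
degIn S v = length (filter (λ w → dist v w ≟ℕ 1) S)

MaxDegreeOne : ∀ {n k} → List (Word n k) → Set
MaxDegreeOne S = All (λ v → degIn S v ≤ 1) S × Any (λ v → degIn S v ≡ 1) S

-- Deleting the first coordinate is injective on an independent set of H(n,k), since two words
-- that differ only there are adjacent; so α(H(n,k)) ≤ k^(n-1). Conversely, write r(w) for the digit
-- sum of w mod k, and build sets T_n of k^(n-1)+1 words, all with r ∈ {0,1}, inducing maximum
-- degree at most 1: T_1 = {0,1}, and T_(n+1) consists of the words 0·t with t ∈ T_n together with,
-- for each head a ≥ 1, the words a·t with r(t) = θ(a). A residue class is independent, because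
-- changing one digit changes r, and has k^(n-1) elements; θ(a) ≥ 2 keeps the new layers away from
-- the words 0·t; and θ is injective except for θ(1) = θ(2), so the only edges between layers form
-- a perfect matching between heads 1 and 2. Any α+1 words of T_n induce a subgraph of maximum
-- degree at most 1, and it is not independent since it has more than α vertices.
module Submission where

open import Defs
open import Data.Nat using (ℕ; zero; suc; _+_; _*_; _∸_; _^_; _≤_; _<_; z≤n; s≤s; _%_; NonZero; >-nonZero⁻¹)
open import Data.Nat.Properties
open import Data.Nat.DivMod using (%-distribˡ-+; m%n%n≡m%n; [m+n]%n≡m%n; m%n<n; m<n⇒m%n≡m; n%n≡0)
open import Data.Nat.ListAction using (sum)
open import Data.Fin using (Fin; zero; suc; toℕ; fromℕ<)
open import Data.Fin.Properties using (toℕ<n; toℕ-fromℕ<; toℕ-injective) renaming (_≟_ to _≟ᶠ_)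
open import Data.Vec using ([]; _∷_; tail)
open import Data.List using (List; []; _∷_; _++_; length; filter; map; take; allFin; tabulate; cartesianProductWith)
open import Data.List.Properties using (length-++; length-map; length-take; length-removeAt′; length-tabulate; filter-++; filter-≐; filter-some; map-tabulate)
open import Data.List.Relation.Unary.All as All using (All; []; _∷_; all?)
import Data.List.Relation.Unary.All.Properties as All
open import Data.List.Relation.Unary.All.Properties.Core using (¬All⇒Any¬)
open import Data.List.Relation.Unary.Any as Any using (Any; here; there; index)
open import Data.List.Relation.Unary.Unique.Propositional using (Unique; []; _∷_)
import Data.List.Relation.Unary.Unique.Propositional.Properties as Unique
open import Data.List.Membership.Propositional using (_∈_; _─_; find; lose)
open import Data.List.Membership.Propositional.Properties using (∈-filter⁻; ∈-allFin; ∈-cartesianProductWith⁺)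
open import Data.Product using (Σ; _×_; _,_; proj₂)
open import Data.Sum using (_⊎_; inj₁; inj₂)
open import Data.Bool using (true; false)
open import Data.Empty using (⊥-elim)
open import Function using (_∘_; id)
open import Relation.Nullary using (¬_; Dec; yes; no; does; ¬?)
open import Relation.Nullary.Decidable using (decidable-stable)
open import Relation.Unary using (Pred; Decidable; _≐_)
open import Relation.Binary.PropositionalEquality

module _ {A : Set} where

  ∈-─⁺ : ∀ {x y : A} {xs} (x∈xs : x ∈ xs) → y ∈ xs → y ≢ x → y ∈ xs ─ x∈xs
  ∈-─⁺ (here refl) (here refl) y≢x = ⊥-elim (y≢x refl)
  ∈-─⁺ (here refl) (there y∈xs) _  = y∈xs
  ∈-─⁺ (there _)   (here refl)  _  = here refl
  ∈-─⁺ (there x∈xs) (there y∈xs) y≢x = there (∈-─⁺ x∈xs y∈xs y≢x)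

  Unique-length≤1 : ∀ {xs : List A} → Unique xs → (∀ {x y} → x ∈ xs → y ∈ xs → x ≡ y) →
    length xs ≤ 1
  Unique-length≤1 {[]}        _                _   = z≤n
  Unique-length≤1 {_ ∷ []}    _                _   = s≤s z≤n
  Unique-length≤1 {_ ∷ _ ∷ _} ((x≢y ∷ _) ∷ _) all≡ =
    ⊥-elim (x≢y (all≡ (here refl) (there (here refl))))

module _ {A B : Set} (f : A → B) where

  length-≤-injection : ∀ {xs ys} → Unique xs →
    (∀ {x y} → x ∈ xs → y ∈ xs → f x ≡ f y → x ≡ y) → (∀ {x} → x ∈ xs → f x ∈ ys) →
    length xs ≤ length ys
  length-≤-injection {[]}     _              _   _    = z≤n
  length-≤-injection {x ∷ xs} {ys} (x∉xs ∷ xs!) inj into =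
    subst (suc (length xs) ≤_) (sym (length-removeAt′ ys (index fx∈ys)))
      (s≤s (length-≤-injection xs! (λ p q → inj (there p) (there q)) into─))
    where
    fx∈ys : f x ∈ ys
    fx∈ys = into (here refl)
    into─ : ∀ {y} → y ∈ xs → f y ∈ ys ─ fx∈ys
    into─ y∈xs = ∈-─⁺ fx∈ys (into (there y∈xs))
      (λ fy≡fx → All.lookup x∉xs y∈xs (inj (here refl) (there y∈xs) (sym fy≡fx)))

module _ {A B : Set} {p} {P : Pred B p} (P? : Decidable P) where

  length-filter-map : (f : A → B) (xs : List A) → length (filter P? (map f xs)) ≡ length (filter (P? ∘ f) xs)
  length-filter-map f [] = refl
  length-filter-map f (x ∷ xs) with does (P? (f x))
  ... | true  = cong suc (length-filter-map f xs)
  ... | false = length-filter-map f xs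

  length-filter-cartesianProductWith : ∀ {C : Set} (f : C → A → B) xs ys →
    length (filter P? (cartesianProductWith f xs ys)) ≡ sum (map (λ x → length (filter (P? ∘ f x) ys)) xs)
  length-filter-cartesianProductWith f []       ys = refl
  length-filter-cartesianProductWith f (x ∷ xs) ys = begin
    length (filter P? (map (f x) ys ++ rest))
      ≡⟨ cong length (filter-++ P? (map (f x) ys) rest) ⟩
    length (filter P? (map (f x) ys) ++ filter P? rest)
      ≡⟨ length-++ (filter P? (map (f x) ys)) ⟩
    length (filter P? (map (f x) ys)) + length (filter P? rest)
      ≡⟨ cong₂ _+_ (length-filter-map (f x) ys) (length-filter-cartesianProductWith f xs ys) ⟩
    _ ∎
    where
    open ≡-Reasoning
    rest : List B
    rest = cartesianProductWith f xs ys

length-cartesianProductWith : ∀ {A B C : Set} (f : A → B → C) xs ys →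
  length (cartesianProductWith f xs ys) ≡ length xs * length ys
length-cartesianProductWith f []       ys = refl
length-cartesianProductWith f (x ∷ xs) ys =
  trans (length-++ (map (f x) ys)) (cong₂ _+_ (length-map (f x) ys) (length-cartesianProductWith f xs ys))

sum-tabulate-const : ∀ {n} {f : Fin n → ℕ} {c} → (∀ i → f i ≡ c) → sum (tabulate f) ≡ n * c
sum-tabulate-const {zero}  f≡c = refl
sum-tabulate-const {suc n} f≡c = cong₂ _+_ (f≡c zero) (sum-tabulate-const (f≡c ∘ suc))

module _ {d : ℕ} .{{_ : NonZero d}} where

  [m+n%d]%d≡[m+n]%d : ∀ m n → (m + n % d) % d ≡ (m + n) % d
  [m+n%d]%d≡[m+n]%d m n = begin
    (m + n % d) % d           ≡⟨ %-distribˡ-+ m (n % d) d ⟩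
    (m % d + n % d % d) % d   ≡⟨ cong (λ r → (m % d + r) % d) (m%n%n≡m%n n d) ⟩
    (m % d + n % d) % d       ≡⟨ %-distribˡ-+ m n d ⟨
    (m + n) % d               ∎
    where open ≡-Reasoning

  +-%-inverse : ∀ {x y} → x + y ≡ d → ∀ a → (x + (y + a) % d) % d ≡ a % d
  +-%-inverse {x} {y} x+y≡d a = begin
    (x + (y + a) % d) % d   ≡⟨ [m+n%d]%d≡[m+n]%d x (y + a) ⟩
    (x + (y + a)) % d       ≡⟨ cong (_% d) (+-assoc x y a) ⟨
    (x + y + a) % d         ≡⟨ cong (λ z → (z + a) % d) x+y≡d ⟩
    (d + a) % d             ≡⟨ cong (_% d) (+-comm d a) ⟩
    (a + d) % d             ≡⟨ [m+n]%n≡m%n a d ⟩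
    a % d                   ∎
    where open ≡-Reasoning

  +-%-solution-unique : ∀ {h a c} → h ≤ d → a < d → (h + a) % d ≡ c → a ≡ ((d ∸ h) + c) % d
  +-%-solution-unique {h} {a} h≤d a<d refl = begin
    a                               ≡⟨ m<n⇒m%n≡m a<d ⟨
    a % d                           ≡⟨ +-%-inverse (m∸n+n≡m h≤d) a ⟨
    ((d ∸ h) + (h + a) % d) % d     ∎
    where open ≡-Reasoning

  +-%-solution : ∀ {h c} → h ≤ d → c < d → (h + ((d ∸ h) + c) % d) % d ≡ c
  +-%-solution h≤d c<d = trans (+-%-inverse (m+[n∸m]≡n h≤d) _) (m<n⇒m%n≡m c<d)

  +-%-cancelˡ : ∀ {h a b} → h ≤ d → a < d → b < d → (h + a) % d ≡ (h + b) % d → a ≡ b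
  +-%-cancelˡ h≤d a<d b<d eq =
    trans (+-%-solution-unique h≤d a<d refl) (sym (+-%-solution-unique h≤d b<d (sym eq)))

  +-%-cancelʳ : ∀ {h a b} → h ≤ d → a < d → b < d → (a + h) % d ≡ (b + h) % d → a ≡ b
  +-%-cancelʳ {h} {a} {b} h≤d a<d b<d eq = +-%-cancelˡ h≤d a<d b<d
    (trans (cong (_% d) (+-comm h a)) (trans eq (cong (_% d) (+-comm b h))))

module _ {k : ℕ} where

  dist-refl : ∀ {n} (w : Word n k) → dist w w ≡ 0
  dist-refl []      = refl
  dist-refl (h ∷ w) with h ≟ᶠ h
  ... | yes _   = dist-refl w
  ... | no h≢h  = ⊥-elim (h≢h refl)

  dist≡0⇒≡ : ∀ {n} {v w : Word n k} → dist v w ≡ 0 → v ≡ w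
  dist≡0⇒≡ {v = []}    {[]}     _    = refl
  dist≡0⇒≡ {v = h ∷ v} {h′ ∷ w} d≡0 with h ≟ᶠ h′
  ... | yes refl = cong (h ∷_) (dist≡0⇒≡ d≡0)

  Adj-∷⁻ : ∀ {n} {h h′ : Fin k} {v w : Word n k} → Adj (h ∷ v) (h′ ∷ w) →
    (h ≡ h′ × Adj v w) ⊎ (h ≢ h′ × v ≡ w)
  Adj-∷⁻ {h = h} {h′} adj with h ≟ᶠ h′
  ... | yes h≡h′ = inj₁ (h≡h′ , adj)
  ... | no  h≢h′ = inj₂ (h≢h′ , dist≡0⇒≡ (suc-injective adj))

  Adj-∷-head : ∀ {n} {h h′ : Fin k} (w : Word n k) → h ≢ h′ → Adj (h ∷ w) (h′ ∷ w)
  Adj-∷-head {h = h} {h′} w h≢h′ with h ≟ᶠ h′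
  ... | yes h≡h′ = ⊥-elim (h≢h′ h≡h′)
  ... | no  _    = cong suc (dist-refl w)

words : ∀ k m → List (Word m k)
words k zero    = [] ∷ []
words k (suc m) = cartesianProductWith _∷_ (allFin k) (words k m)

∈-words : ∀ {k m} (w : Word m k) → w ∈ words k m
∈-words []      = here refl
∈-words (h ∷ w) = ∈-cartesianProductWith⁺ _∷_ (∈-allFin h) (∈-words w)

words-unique : ∀ k m → Unique (words k m)
words-unique k zero    = [] ∷ []
words-unique k (suc m) = Unique.cartesianProductWith⁺ _∷_ ∷-injective (Unique.allFin⁺ k) (words-unique k m)
  where
  ∷-injective : ∀ {h h′ : Fin k} {v w : Word m k} → h ∷ v ≡ h′ ∷ w → h ≡ h′ × v ≡ w
  ∷-injective refl = refl , refl

length-words : ∀ k m → length (words k m) ≡ k ^ m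
length-words k zero    = refl
length-words k (suc m) = trans (length-cartesianProductWith _∷_ (allFin k) (words k m))
  (cong₂ _*_ (length-tabulate {n = k} id) (length-words k m))

Independent-length≤ : ∀ {m k} {S : List (Word (suc m) k)} → Unique S → Independent S → length S ≤ k ^ m
Independent-length≤ {m} {k} {S} S! S-independent =
  subst (length S ≤_) (length-words k m)
    (length-≤-injection tail S! tail-injective (λ {w} _ → ∈-words (tail w)))
  where
  tail-injective : ∀ {v w} → v ∈ S → w ∈ S → tail v ≡ tail w → v ≡ w
  tail-injective {h ∷ t} {h′ ∷ _} v∈S w∈S refl with h ≟ᶠ h′
  ... | yes refl = refl
  ... | no  h≢h′ = ⊥-elim (All.lookup (All.lookup S-independent v∈S) w∈S (Adj-∷-head t h≢h′))

adj? : ∀ {n k} (v w : Word n k) → Dec (Adj v w)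
adj? v w = dist v w ≟ 1

degIn≤1 : ∀ {n k} {S : List (Word n k)} {v} → Unique S →
  (∀ {w w′} → w ∈ S → w′ ∈ S → Adj v w → Adj v w′ → w ≡ w′) → degIn S v ≤ 1
degIn≤1 {S = S} {v} S! neighbour-unique = Unique-length≤1 (Unique.filter⁺ (adj? v) S!) λ w∈ w′∈ →
  let w∈S , v~w = ∈-filter⁻ (adj? v) {xs = S} w∈
      w′∈S , v~w′ = ∈-filter⁻ (adj? v) {xs = S} w′∈
  in neighbour-unique w∈S w′∈S v~w v~w′

maxDegreeOne : ∀ {n k} {S : List (Word n k)} → All (λ v → degIn S v ≤ 1) S → ¬ Independent S →
  MaxDegreeOne S
maxDegreeOne {S = S} deg≤1 ¬independent
  with find (¬All⇒Any¬ (λ v → all? (λ w → ¬? (adj? v w)) S) S ¬independent)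
... | v , v∈S , ¬isolated =
  deg≤1 , lose v∈S (≤-antisym (All.lookup deg≤1 v∈S) (filter-some (adj? v) neighbour))
  where
  neighbour : Any (Adj v) S
  neighbour = Any.map (λ {w} → decidable-stable (adj? v w)) (¬All⇒Any¬ (λ w → ¬? (adj? v w)) S ¬isolated)

residue : ∀ {m k} .{{_ : NonZero k}} → Word m k → ℕ
residue             []      = 0
residue {k = k} (h ∷ t) = (toℕ h + residue t) % k

module _ {k : ℕ} .{{_ : NonZero k}} where

  residue<k : ∀ {m} (w : Word m k) → residue w < k
  residue<k []      = >-nonZero⁻¹ k
  residue<k (h ∷ t) = m%n<n (toℕ h + residue t) k

  residue-[_] : (h : Fin k) → residue (h ∷ []) ≡ toℕ h
  residue-[ h ] = trans (cong (_% k) (+-identityʳ (toℕ h))) (m<n⇒m%n≡m (toℕ<n h))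

  Adj⇒residue≢ : ∀ {m} {v w : Word m k} → Adj v w → residue v ≢ residue w
  Adj⇒residue≢ {v = []}    {[]} ()
  Adj⇒residue≢ {v = h ∷ v} {h′ ∷ w} v~w eq with Adj-∷⁻ {h = h} {h′} {v} {w} v~w
  ... | inj₁ (refl , v~w′) =
    Adj⇒residue≢ {v = v} {w} v~w′ (+-%-cancelˡ (<⇒≤ (toℕ<n h)) (residue<k v) (residue<k w) eq)
  ... | inj₂ (h≢h′ , refl) =
    h≢h′ (toℕ-injective (+-%-cancelʳ (<⇒≤ (residue<k v)) (toℕ<n h) (toℕ<n h′) eq))

  residue≟ : ∀ {m} c (w : Word m k) → Dec (residue w ≡ c)
  residue≟ c w = residue w ≟ c

  length-residueClass : ∀ m {c} → c < k → length (filter (residue≟ c) (words k (suc m))) ≡ k ^ m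
  length-residueClass zero {c} c<k = ≤-antisym
    (Unique-length≤1 (Unique.filter⁺ (residue≟ c) (words-unique k 1)) same-word)
    (filter-some (residue≟ c)
      (lose (∈-words (fromℕ< c<k ∷ [])) (trans residue-[ fromℕ< c<k ] (toℕ-fromℕ< c<k))))
    where
    same-word : ∀ {v w} → v ∈ filter (residue≟ c) (words k 1) → w ∈ filter (residue≟ c) (words k 1) →
      v ≡ w
    same-word {h ∷ []} {h′ ∷ []} v∈ w∈ = cong (_∷ []) (toℕ-injective (begin
      toℕ h              ≡⟨ residue-[ h ] ⟨
      residue (h ∷ [])   ≡⟨ proj₂ (∈-filter⁻ (residue≟ c) {xs = words k 1} v∈) ⟩
      c                  ≡⟨ proj₂ (∈-filter⁻ (residue≟ c) {xs = words k 1} w∈) ⟨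
      residue (h′ ∷ [])  ≡⟨ residue-[ h′ ] ⟩
      toℕ h′             ∎))
      where open ≡-Reasoning
  length-residueClass (suc m) {c} c<k = begin
    length (filter (residue≟ c) (words k (suc (suc m))))
      ≡⟨ length-filter-cartesianProductWith (residue≟ c) _∷_ (allFin k) (words k (suc m)) ⟩
    sum (map row (allFin k))
      ≡⟨ cong sum (map-tabulate id row) ⟩
    sum (tabulate row)
      ≡⟨ sum-tabulate-const row≡ ⟩
    k * k ^ m ∎
    where
    open ≡-Reasoning
    row : Fin k → ℕ
    row h = length (filter (residue≟ c ∘ (h ∷_)) (words k (suc m)))
    row≡ : ∀ h → row h ≡ k ^ m
    row≡ h = trans
      (cong length (filter-≐ (residue≟ c ∘ (h ∷_)) (residue≟ shifted) class≐ (words k (suc m))))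
      (length-residueClass m (m%n<n ((k ∸ toℕ h) + c) k))
      where
      shifted : ℕ
      shifted = ((k ∸ toℕ h) + c) % k
      h≤k : toℕ h ≤ k
      h≤k = <⇒≤ (toℕ<n h)
      class≐ : (λ (t : Word (suc m) k) → residue (h ∷ t) ≡ c) ≐ (λ t → residue t ≡ shifted)
      class≐ = (λ {t} → +-%-solution-unique h≤k (residue<k t))
             , (λ {t} t≡ → trans (cong (λ r → (toℕ h + r) % k) t≡) (+-%-solution h≤k c<k))

swap01 : ∀ {n} → Fin (suc (suc n)) → Fin (suc (suc n))
swap01 zero          = suc zero
swap01 (suc zero)    = zero
swap01 (suc (suc x)) = suc (suc x)

≢⇒≡swap01 : ∀ {n} {a b : Fin (suc (suc n))} → toℕ a ≤ 1 → toℕ b ≤ 1 → a ≢ b → b ≡ swap01 a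
≢⇒≡swap01 {a = suc (suc _)} (s≤s ()) _ _
≢⇒≡swap01 {b = suc (suc _)} _ (s≤s ()) _
≢⇒≡swap01 {a = zero}     {zero}     _ _ a≢b = ⊥-elim (a≢b refl)
≢⇒≡swap01 {a = zero}     {suc zero} _ _ _   = refl
≢⇒≡swap01 {a = suc zero} {zero}     _ _ _   = refl
≢⇒≡swap01 {a = suc zero} {suc zero} _ _ a≢b = ⊥-elim (a≢b refl)

module SparseConstruction (j : ℕ) where

  k : ℕ
  k = suc (suc (suc j))

  toℕ≤1+j : (x : Fin j) → toℕ x ≤ suc j
  toℕ≤1+j x = ≤-trans (<⇒≤ (toℕ<n x)) (n≤1+n j)

  -- θ a is the residue class of the tails following the head suc a. Its values make
  -- (suc a + θ a) mod k equal 0 for a = 0 and 1 otherwise.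
  θ : Fin (suc (suc j)) → ℕ
  θ zero          = suc (suc j)
  θ (suc zero)    = suc (suc j)
  θ (suc (suc x)) = suc j ∸ toℕ x

  θ-low : ∀ x → θ (suc (suc x)) < suc (suc j)
  θ-low x = s≤s (m∸n≤m (suc j) (toℕ x))

  θ<k : ∀ a → θ a < k
  θ<k zero          = n<1+n (suc (suc j))
  θ<k (suc zero)    = n<1+n (suc (suc j))
  θ<k (suc (suc x)) = <-trans (θ-low x) (n<1+n (suc (suc j)))

  θ≥2 : ∀ a → 2 ≤ θ a
  θ≥2 zero          = s≤s (s≤s z≤n)
  θ≥2 (suc zero)    = s≤s (s≤s z≤n)
  θ≥2 (suc (suc x)) = subst (2 ≤_) (sym (+-∸-assoc 1 (<⇒≤ (toℕ<n x)))) (s≤s (m<n⇒0<n∸m (toℕ<n x)))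

  θ-complement : ∀ a → (toℕ (suc a) + θ a) % k ≤ 1
  θ-complement zero          = ≤-trans (≤-reflexive (n%n≡0 k)) z≤n
  θ-complement (suc zero)    = ≤-reflexive ([m+n]%n≡m%n 1 k)
  θ-complement (suc (suc x)) = ≤-reflexive (trans
    (cong (λ n → (3 + n) % k) (m+[n∸m]≡n (toℕ≤1+j x)))
    ([m+n]%n≡m%n 1 k))

  θ-collision : ∀ {a b} → θ a ≡ θ b → a ≢ b → toℕ a ≤ 1 × toℕ b ≤ 1
  θ-collision {zero}        {zero}        _  a≢b = ⊥-elim (a≢b refl)
  θ-collision {zero}        {suc zero}    _  _   = z≤n , s≤s z≤n
  θ-collision {suc zero}    {zero}        _  _   = s≤s z≤n , z≤n
  θ-collision {suc zero}    {suc zero}    _  a≢b = ⊥-elim (a≢b refl)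
  θ-collision {zero}        {suc (suc y)} eq _   = ⊥-elim (<-irrefl (sym eq) (θ-low y))
  θ-collision {suc zero}    {suc (suc y)} eq _   = ⊥-elim (<-irrefl (sym eq) (θ-low y))
  θ-collision {suc (suc x)} {zero}        eq _   = ⊥-elim (<-irrefl eq (θ-low x))
  θ-collision {suc (suc x)} {suc zero}    eq _   = ⊥-elim (<-irrefl eq (θ-low x))
  θ-collision {suc (suc x)} {suc (suc y)} eq a≢b = ⊥-elim (a≢b (cong (λ z → suc (suc z)) (toℕ-injective
    (∸-cancelˡ-≡ (toℕ≤1+j x) (toℕ≤1+j y) eq))))

  -- Sparse m is the set T_(m+1).
  Sparse : ∀ m → Word (suc m) k → Set
  Sparse zero    (h ∷ [])    = toℕ h ≤ 1
  Sparse (suc m) (zero ∷ t)  = Sparse m t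
  Sparse (suc m) (suc a ∷ t) = residue t ≡ θ a

  sparse? : ∀ m → Decidable (Sparse m)
  sparse? zero    (h ∷ [])    = toℕ h ≤? 1
  sparse? (suc m) (zero ∷ t)  = sparse? m t
  sparse? (suc m) (suc a ∷ t) = residue t ≟ θ a

  Sparse⇒residue≤1 : ∀ m {v} → Sparse m v → residue v ≤ 1
  Sparse⇒residue≤1 zero    {h ∷ []}    h≤1 = subst (_≤ 1) (sym residue-[ h ]) h≤1
  Sparse⇒residue≤1 (suc m) {zero ∷ t}  s   =
    subst (_≤ 1) (sym (m<n⇒m%n≡m (residue<k t))) (Sparse⇒residue≤1 m s)
  Sparse⇒residue≤1 (suc m) {suc a ∷ t} t≡θ =
    subst (λ r → (toℕ (suc a) + r) % k ≤ 1) (sym t≡θ) (θ-complement a)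

  Sparse⇒residue≢θ : ∀ m {t} a → Sparse m t → residue t ≢ θ a
  Sparse⇒residue≢θ m a s t≡θ = ≤⇒≯ (Sparse⇒residue≤1 m s) (subst (1 <_) (sym t≡θ) (θ≥2 a))

  zero-neighbour : ∀ {m t h t′} → Sparse (suc m) (zero ∷ t) → Sparse (suc m) (h ∷ t′) →
    Adj (zero ∷ t) (h ∷ t′) → h ≡ zero × Adj t t′
  zero-neighbour {m} {t} {zero} {t′} _ _ adj with Adj-∷⁻ {h = zero} {zero} {t} {t′} adj
  ... | inj₁ (_ , t~t′) = refl , t~t′
  ... | inj₂ (0≢0 , _)  = ⊥-elim (0≢0 refl)
  zero-neighbour {m} {t} {suc a} {t′} s s′ adj with Adj-∷⁻ {h = zero} {suc a} {t} {t′} adj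
  ... | inj₂ (_ , refl) = ⊥-elim (Sparse⇒residue≢θ m a s s′)

  suc-neighbour : ∀ {m a t w} → Sparse (suc m) (suc a ∷ t) → Sparse (suc m) w →
    Adj (suc a ∷ t) w → w ≡ suc (swap01 a) ∷ t
  suc-neighbour {m} {a} {t} {zero ∷ t′} s s′ adj with Adj-∷⁻ {h = suc a} {zero} {t} {t′} adj
  ... | inj₂ (_ , refl) = ⊥-elim (Sparse⇒residue≢θ m a s′ s)
  suc-neighbour {m} {a} {t} {suc b ∷ t′} s s′ adj with Adj-∷⁻ {h = suc a} {suc b} {t} {t′} adj
  ... | inj₁ (refl , t~t′) = ⊥-elim (Adj⇒residue≢ {v = t} {t′} t~t′ (trans s (sym s′)))
  ... | inj₂ (sa≢sb , refl) with θ-collision (trans (sym s) s′) (sa≢sb ∘ cong suc)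
  ...   | a≤1 , b≤1 = cong (λ x → suc x ∷ t) (≢⇒≡swap01 a≤1 b≤1 (sa≢sb ∘ cong suc))

  Sparse-neighbour-unique : ∀ m {v w w′} → Sparse m v → Sparse m w → Sparse m w′ →
    Adj v w → Adj v w′ → w ≡ w′
  Sparse-neighbour-unique zero {h ∷ []} {h₁ ∷ []} {h₂ ∷ []} s s₁ s₂ v~w v~w′ =
    cong (_∷ []) (trans (≢⇒≡swap01 s s₁ (head≢ v~w)) (sym (≢⇒≡swap01 s s₂ (head≢ v~w′))))
    where
    head≢ : ∀ {h′} → Adj (h ∷ []) (h′ ∷ []) → h ≢ h′
    head≢ {h′} adj with Adj-∷⁻ {h = h} {h′} {[]} {[]} adj
    ... | inj₂ (h≢h′ , _) = h≢h′
  Sparse-neighbour-unique (suc m) {zero ∷ t} {h₁ ∷ t₁} {h₂ ∷ t₂} s s₁ s₂ v~w v~w′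
    with zero-neighbour {m} {t} {h₁} {t₁} s s₁ v~w | zero-neighbour {m} {t} {h₂} {t₂} s s₂ v~w′
  ... | refl , t~t₁ | refl , t~t₂ = cong (zero ∷_) (Sparse-neighbour-unique m s s₁ s₂ t~t₁ t~t₂)
  Sparse-neighbour-unique (suc m) {suc a ∷ t} {w} {w′} s s₁ s₂ v~w v~w′ =
    trans (suc-neighbour {m} {a} {t} {w} s s₁ v~w) (sym (suc-neighbour {m} {a} {t} {w′} s s₂ v~w′))

  sparseWords : ∀ m → List (Word (suc m) k)
  sparseWords m = filter (sparse? m) (words k (suc m))

  length-sparseWords : ∀ m → length (sparseWords m) ≡ suc (k ^ m)
  length-sparseWords m = begin
    length (filter (sparse? m) (words k (suc m)))
      ≡⟨ length-filter-cartesianProductWith (sparse? m) _∷_ (allFin k) (words k m) ⟩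
    sum (map (row m) (allFin k))
      ≡⟨ cong sum (map-tabulate id (row m)) ⟩
    sum (tabulate (row m))
      ≡⟨ rows m ⟩
    suc (k ^ m) ∎
    where
    open ≡-Reasoning
    row : ∀ m → Fin k → ℕ
    row m h = length (filter (sparse? m ∘ (h ∷_)) (words k m))
    -- For m = 0 only the rows of the heads 0 and 1 are non-empty; for m + 1, row 0 is
    -- sparseWords m and row (suc a) is the residue class θ a.
    rows : ∀ m → sum (tabulate (row m)) ≡ suc (k ^ m)
    rows zero    = cong (2 +_) (trans (sum-tabulate-const {j} (λ _ → refl)) (*-zeroʳ j))
    rows (suc m) = cong₂ _+_ (length-sparseWords m) (sum-tabulate-const (λ a → length-residueClass m (θ<k a)))

theorem1 : (n k : ℕ) → 1 ≤ n → 3 ≤ k → (α : ℕ) → IsIndependenceNumber n k α →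
    Σ (List (Word n k)) (λ S → Unique S × length S ≡ suc α × MaxDegreeOne S)
theorem1 zero    _ () _ _ _
theorem1 (suc m) 0 _ () _ _
theorem1 (suc m) 1 _ (s≤s ()) _ _
theorem1 (suc m) 2 _ (s≤s (s≤s ())) _ _
theorem1 (suc m) (suc (suc (suc j))) _ _ α ((S , S! , S-independent , |S|≡α) , maximum) =
  X , X! , |X|≡1+α , maxDegreeOne (All.tabulate degree≤1) ¬independent
  where
  open SparseConstruction j
  α≤k^m : α ≤ k ^ m
  α≤k^m = subst (_≤ k ^ m) |S|≡α (Independent-length≤ S! S-independent)
  X : List (Word (suc m) k)
  X = take (suc α) (sparseWords m)
  X! : Unique X
  X! = Unique.take⁺ (suc α) (Unique.filter⁺ (sparse? m) (words-unique k (suc m)))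
  |X|≡1+α : length X ≡ suc α
  |X|≡1+α = trans (length-take (suc α) (sparseWords m))
    (m≤n⇒m⊓n≡m (subst (suc α ≤_) (sym (length-sparseWords m)) (s≤s α≤k^m)))
  X-sparse : ∀ {v} → v ∈ X → Sparse m v
  X-sparse = All.lookup (All.take⁺ (suc α) (All.all-filter (sparse? m) (words k (suc m))))
  degree≤1 : ∀ {v} → v ∈ X → degIn X v ≤ 1
  degree≤1 {v} v∈X = degIn≤1 {v = v} X! λ w∈X w′∈X →
    Sparse-neighbour-unique m (X-sparse v∈X) (X-sparse w∈X) (X-sparse w′∈X)
  ¬independent : ¬ Independent X
  ¬independent X-independent = 1+n≰n (subst (_≤ α) |X|≡1+α (maximum X X! X-independent))
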